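{- Let $n\in\mathbb{N}\cup\{\infty\}$, let $V$ be a type with an equivalence $\sup:\mathsf{T}^n_U V\simeq V$, equipped with the induced relation $y\in x:=\mathrm{fib}\,\widetilde{x}\,y$. Let $k\in\mathbb{N}\cup\{\infty\}$ with $k\le n$, and suppose $V$ is $(k+1)$-locally $U$-small. Then $(V,\in)$ has $k$-union: for every $x:V$ there is $\bigcup_k x:V$ such that for all $z:V$, $z\in\bigcup_k x\simeq\big\|\sum_{y:V}(z\in y)\times(y\in x)\big\|_{k-1}$.
   Context: Homotopy type theory with univalent universes $U:\mathsf{Type}$, function extensionality; $\|-\|_j$ is $j$-truncation, with $\|P\|_\infty:=P$ and $\infty\pm1=\infty$. A map is $j$-truncated if its homotopy fibers are $j$-types; $A\hookrightarrow_j X$ is the type of $j$-truncated maps; $\mathsf{T}^n_U X:=\sum_{A:U}(A\hookrightarrow_{n-1}X)$. For $x:V$ write $\sup^{ -1}x=(\overline{x},\widetilde{x})$ with $\overline{x}:U$, $\widetilde{x}:\overline{x}\hookrightarrow_{n-1}V$; $\mathrm{fib}\,g\,y:=\sum_a g\,a=y$. A type is essentially $U$-small if equivalent to a type in $U$; $0$-locally $U$-small means essentially $U$-small, $(j+1)$-locally $U$-small means all identity types are $j$-locally $U$-small, and every type is $\infty$-locally $U$-small. Standing assumption (small images): for every $A:U$, every $1$-locally $U$-small type $X$ and $f:A\to X$ there is $\mathrm{im}\,f:U$ with a surjection $A\twoheadrightarrow\mathrm{im}\,f$ and an embedding $\mathrm{im}\,f\hookrightarrow X$ composing definitionally to $f$.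 -}

{-# OPTIONS --without-K #-}
module Defs where

open import Level using (Level; _⊔_; suc; Setω)
open import Data.Nat using (ℕ; zero) renaming (suc to sucℕ; _≤_ to _≤ℕ_)
open import Data.Unit.Polymorphic using (⊤)
open import Data.Product using (Σ; _×_; _,_; proj₁; proj₂)
open import Relation.Binary.PropositionalEquality using (_≡_; refl)

data ℕ∞ : Set where
  fin : ℕ → ℕ∞
  ∞   : ℕ∞

suc∞ : ℕ∞ → ℕ∞
suc∞ (fin m) = fin (sucℕ m)
suc∞ ∞       = ∞

data _≤∞_ : ℕ∞ → ℕ∞ → Set where
  fin≤fin : ∀ {m n} → m ≤ℕ n → fin m ≤∞ fin n
  _≤∞∞    : ∀ m → m ≤∞ ∞

isContr : ∀ {a} → Set a → Set a
isContr A = Σ A λ c → ∀ x → c ≡ x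

isProp : ∀ {a} → Set a → Set a
isProp A = (x y : A) → x ≡ y

fib : ∀ {a b} {A : Set a} {B : Set b} → (A → B) → B → Set (a ⊔ b)
fib {A = A} g y = Σ A λ a → g a ≡ y

isEquiv : ∀ {a b} {A : Set a} {B : Set b} → (A → B) → Set (a ⊔ b)
isEquiv f = ∀ y → isContr (fib f y)

_≃_ : ∀ {a b} → Set a → Set b → Set (a ⊔ b)
A ≃ B = Σ (A → B) isEquiv

equivFun : ∀ {a b} {A : Set a} {B : Set b} → A ≃ B → A → B
equivFun e = proj₁ e

invEq : ∀ {a b} {A : Set a} {B : Set b} → A ≃ B → B → A
invEq e y = proj₁ (proj₁ (proj₂ e y))

Is[_-1]Type : ∀ {a} → ℕ∞ → Set a → Set a
Is[ fin zero     -1]Type A = isProp A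
Is[ fin (sucℕ m) -1]Type A = (x y : A) → Is[ fin m -1]Type (x ≡ y)
Is[ ∞            -1]Type A = ⊤

IsTruncMap[_-1] : ∀ {a b} {A : Set a} {B : Set b} → ℕ∞ → (A → B) → Set (a ⊔ b)
IsTruncMap[_-1] {B = B} n f = (y : B) → Is[ n -1]Type (fib f y)

_↪[_-1]_ : ∀ {a b} → Set a → ℕ∞ → Set b → Set (a ⊔ b)
A ↪[ n -1] X = Σ (A → X) IsTruncMap[ n -1]

isEmbedding : ∀ {a b} {A : Set a} {B : Set b} → (A → B) → Set (a ⊔ b)
isEmbedding = IsTruncMap[ fin zero -1]

T[_,_] : ∀ {b} → ℕ∞ → (ℓ : Level) → Set b → Set (suc ℓ ⊔ b)
T[ n , ℓ ] X = Σ (Set ℓ) λ A → A ↪[ n -1] X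

EssSmall : ∀ {b} → (ℓ : Level) → Set b → Set (suc ℓ ⊔ b)
EssSmall ℓ X = Σ (Set ℓ) λ B → B ≃ X

LocSmall : ∀ {b} → ℕ∞ → (ℓ : Level) → Set b → Set (suc ℓ ⊔ b)
LocSmall (fin zero)     ℓ X = EssSmall ℓ X
LocSmall (fin (sucℕ j)) ℓ X = (x y : X) → LocSmall (fin j) ℓ (x ≡ y)
LocSmall ∞              ℓ X = ⊤

idToEquiv : ∀ {a} {A B : Set a} → A ≡ B → A ≃ B
idToEquiv {A = A} refl = (λ x → x) , λ y → (y , refl) , λ { (.y , refl) → refl }

Univalence : Setω
Univalence = ∀ {a} {A B : Set a} → isEquiv (idToEquiv {A = A} {B = B})

happly : ∀ {a b} {A : Set a} {B : A → Set b} {f g : (x : A) → B x} → f ≡ g → (x : A) → f x ≡ g x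
happly refl x = refl

FunExt : Setω
FunExt = ∀ {a b} {A : Set a} {B : A → Set b} {f g : (x : A) → B x} → isEquiv (happly {f = f} {g = g})

record Truncations : Setω where
  field
    ∥_∥[_-1]   : ∀ {a} → Set a → ℕ → Set a
    ∥∥-isTrunc : ∀ {a} {A : Set a} (m : ℕ) → Is[ fin m -1]Type (∥ A ∥[ m -1])
    ∣_∣[_-1]   : ∀ {a} {A : Set a} → A → (m : ℕ) → ∥ A ∥[ m -1]
    ∥∥-elim    : ∀ {a p} {A : Set a} (m : ℕ) (P : ∥ A ∥[ m -1] → Set p)
                 → ((t : ∥ A ∥[ m -1]) → Is[ fin m -1]Type (P t))
                 → ((x : A) → P (∣ x ∣[ m -1]))
                 → (t : ∥ A ∥[ m -1]) → P t
    ∥∥-β       : ∀ {a p} {A : Set a} (m : ℕ) (P : ∥ A ∥[ m -1] → Set p)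
                 (h : (t : ∥ A ∥[ m -1]) → Is[ fin m -1]Type (P t))
                 (f : (x : A) → P (∣ x ∣[ m -1])) (x : A)
                 → ∥∥-elim m P h f (∣ x ∣[ m -1]) ≡ f x

Trunc[_-1] : Truncations → ∀ {a} → ℕ∞ → Set a → Set a
Trunc[ T -1] (fin m) A = Truncations.∥_∥[_-1] T A m
Trunc[ T -1] ∞       A = A

isSurjection : Truncations → ∀ {a b} {A : Set a} {B : Set b} → (A → B) → Set (a ⊔ b)
isSurjection T {B = B} f = (y : B) → Truncations.∥_∥[_-1] T (fib f y) zero

-- Standing assumption (small images) for U = Set ℓ: for A : U, a 1-locally U-small X
-- and f : A → X, an image im f : U with a surjection A ↠ im f and an embedding
-- im f ↪ X whose composite is f (here: pointwise propositionally equal to f).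
record Image (T : Truncations) (ℓ : Level) {b} {A : Set ℓ} {X : Set b} (f : A → X) : Set (suc ℓ ⊔ b) where
  field
    im       : Set ℓ
    cover    : A → im
    cover-surj : isSurjection T cover
    incl     : im → X
    incl-emb : isEmbedding incl
    incl∘cover : (x : A) → incl (cover x) ≡ f x

SmallImages : Truncations → Level → Setω
SmallImages T ℓ = ∀ {b} {A : Set ℓ} {X : Set b} → LocSmall (fin 1) ℓ X → (f : A → X) → Image T ℓ f

over : ∀ {ℓ b} {n : ℕ∞} {V : Set b} → T[ n , ℓ ] V ≃ V → V → Set ℓ
over sup x = proj₁ (invEq sup x)

tilde : ∀ {ℓ b} {n : ℕ∞} {V : Set b} (sup : T[ n , ℓ ] V ≃ V) (x : V) → over sup x → V
tilde sup x = proj₁ (proj₂ (invEq sup x))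

_∈[_]_ : ∀ {ℓ b} {n : ℕ∞} {V : Set b} → V → T[ n , ℓ ] V ≃ V → V → Set (ℓ ⊔ b)
y ∈[ sup ] x = fib (tilde sup x) y

HasUnion : ∀ {ℓ b} {n : ℕ∞} {V : Set b} → Truncations → ℕ∞ → T[ n , ℓ ] V ≃ V → Set (ℓ ⊔ b)
HasUnion {V = V} T k sup =
  (x : V) → Σ V λ u → (z : V) →
    (z ∈[ sup ] u) ≃ Trunc[ T -1] k (Σ V λ y → (z ∈[ sup ] y) × (y ∈[ sup ] x))

{-# OPTIONS --without-K #-}
-- The union of x is sup of the (k-1)-image of the map Σ (a : x̄) (x̃ a)‾ → V sending
-- (a , c) to (x̃ a)~ c, whose fibre over z is Σ y (z ∈ y × y ∈ x); its inclusion is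
-- (k-1)-truncated, so everything hinges on its domain being U-small.  By induction on m, the (m-1)-image of a map
-- f : A → X from a small type into an (m+1)-locally small type is small: it is covered
-- by A, so by small images it suffices that it be 1-locally small; for m = 0 it is a
-- subtype of X, and otherwise the paths between points of the cover form the
-- (m-2)-image of ap f into the m-locally small type f a = f a'.
module Submission where

open import Defs
open import Level using (Level)
open import Data.Nat using (ℕ; zero; z≤n; s≤s) renaming (suc to sucℕ; _≤_ to _≤ℕ_)
open import Data.Product using (Σ; _×_; _,_; proj₁; proj₂)
open import Data.Product.Properties using (Σ-≡,≡↔≡; Σ-≡,≡→≡)
open import Data.Product.Function.Dependent.Propositional using (Σ-↔)
open import Data.Unit.Polymorphic using (tt)
open import Function using (_∘_; id)
open import Function.Bundles using (Inverse; _↔_; mk↔ₛ′)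
open import Function.Properties.Inverse using (↔-refl; ↔-sym; ↔-trans)
open import Function.Related.Propositional using (K-reflexive; module EquationalReasoning)
import Function.Properties.Inverse.HalfAdjointEquivalence as HA
open import Axiom.UniquenessOfIdentityProofs using (module Constant⇒UIP)
open import Relation.Binary.PropositionalEquality
  using (_≡_; refl; sym; trans; cong; subst; trans-symˡ; subst-subst-sym)

private
  variable
    a b c : Level
    A B X : Set a

secEq : (e : A ≃ B) (y : B) → proj₁ e (invEq e y) ≡ y
secEq e y = proj₂ (proj₁ (proj₂ e y))

retEq : (e : A ≃ B) (x : A) → invEq e (proj₁ e x) ≡ x
retEq e x = cong proj₁ (proj₂ (proj₂ e (proj₁ e x)) (x , refl))

≃⇒↔ : A ≃ B → A ↔ B
≃⇒↔ e = mk↔ₛ′ (proj₁ e) (invEq e) (secEq e) (retEq e)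

↔⇒≃ : A ↔ B → A ≃ B
↔⇒≃ A↔B = to , λ y → (from y , right-inverse-of y) , λ { (x , p) → centre≡ x p }
  where
  open HA._≃_ (HA.↔⇒≃ A↔B)
  lift : ∀ {x′ x} (l : x′ ≡ x) (r : to x′ ≡ to x) → cong to l ≡ r
       → _≡_ {A = fib to (to x)} (x′ , r) (x , refl)
  lift refl .refl refl = refl
  centre≡ : ∀ x {y} (p : to x ≡ y) → (from y , right-inverse-of y) ≡ (x , p)
  centre≡ x refl = lift (left-inverse-of x) _ (left-right x)

fib-proj₁↔ : {P : X → Set b} (z : X) → fib (proj₁ {B = P}) z ↔ P z
fib-proj₁↔ {P = P} z = mk↔ₛ′ to (λ q → (z , q) , refl) (λ _ → refl) from∘to
  where
  to : ∀ {z} → fib (proj₁ {B = P}) z → P z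
  to ((_ , q) , refl) = q
  from∘to : ∀ {z} (w : fib (proj₁ {B = P}) z) → ((z , to w) , refl) ≡ w
  from∘to ((_ , _) , refl) = refl

fib-proj₁∘≃ : {P : X → Set c} (e : B ≃ Σ X P) (z : X) → fib (proj₁ ∘ proj₁ e) z ↔ P z
fib-proj₁∘≃ e z = ↔-trans (Σ-↔ (≃⇒↔ e) ↔-refl) (fib-proj₁↔ z)

Σ-isContr-snd : {P : X → Set b} → (∀ x → isContr (P x)) → Σ X P ↔ X
Σ-isContr-snd h = mk↔ₛ′ proj₁ (λ x → x , proj₁ (h x)) (λ _ → refl)
  (λ { (x , p) → cong (x ,_) (proj₂ (h x) p) })

fib-≡↔fib-cong : (f : A → X) {x x′ : A} (q : f x ≡ f x′)
  → (_≡_ {A = fib f (f x′)} (x , q) (x′ , refl)) ↔ fib (cong f) q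
fib-≡↔fib-cong f q = mk↔ₛ′ (to q) (from q) (to∘from q) (from∘to q)
  where
  to : ∀ {x x′} (q : f x ≡ f x′) → _≡_ {A = fib f (f x′)} (x , q) (x′ , refl) → fib (cong f) q
  to q refl = refl , refl
  from : ∀ {x x′} (q : f x ≡ f x′) → fib (cong f) q → _≡_ {A = fib f (f x′)} (x , q) (x′ , refl)
  from .(cong f refl) (refl , refl) = refl
  to∘from : ∀ {x x′} (q : f x ≡ f x′) (w : fib (cong f) q) → to q (from q w) ≡ w
  to∘from .(cong f refl) (refl , refl) = refl
  from∘to : ∀ {x x′} (q : f x ≡ f x′) (p : _≡_ {A = fib f (f x′)} (x , q) (x′ , refl)) → from q (to q p) ≡ p
  from∘to q refl = refl

isTrunc : ℕ → Set a → Set a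
isTrunc m = Is[ fin m -1]Type

isProp⇒isSet : isProp A → (x y : A) → isProp (x ≡ y)
isProp⇒isSet pA _ _ = Constant⇒UIP.≡-irrelevant (λ {x} {y} _ → pA x y) (λ _ _ → refl)

isTrunc-suc : ∀ m → isTrunc m A → isTrunc (sucℕ m) A
isTrunc-suc zero     h = isProp⇒isSet h
isTrunc-suc (sucℕ m) h x y = isTrunc-suc m (h x y)

isTrunc-≤ : ∀ {m m′} → m ≤ℕ m′ → isTrunc m A → isTrunc m′ A
isTrunc-≤ {m′ = zero}    z≤n h = h
isTrunc-≤ {m′ = sucℕ m′} z≤n h = isTrunc-suc m′ (isTrunc-≤ z≤n h)
isTrunc-≤ (s≤s m≤m′) h x y = isTrunc-≤ m≤m′ (h x y)

isTrunc-≤∞ : ∀ {m n} → fin m ≤∞ n → isTrunc m A → Is[ n -1]Type A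
isTrunc-≤∞ (fin≤fin m≤n) h = isTrunc-≤ m≤n h
isTrunc-≤∞ (_ ≤∞∞)       h = tt

isTrunc-retract : ∀ m (s : B → A) (r : A → B) → (∀ y → r (s y) ≡ y) → isTrunc m A → isTrunc m B
isTrunc-retract zero s r ε pA y y′ = trans (sym (ε y)) (trans (cong r (pA (s y) (s y′))) (ε y′))
isTrunc-retract (sucℕ m) s r ε hA y y′ =
  isTrunc-retract m (cong s) (λ q → trans (sym (ε y)) (trans (cong r q) (ε y′))) conj (hA (s y) (s y′))
  where
  conj : ∀ {y′} (p : y ≡ y′) → trans (sym (ε y)) (trans (cong r (cong s p)) (ε y′)) ≡ p
  conj refl = trans-symˡ (ε y)

isTrunc-↔ : ∀ m → A ↔ B → isTrunc m A → isTrunc m B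
isTrunc-↔ m A↔B = isTrunc-retract m from to strictlyInverseˡ
  where open Inverse A↔B

isTrunc-Σ : ∀ m {P : A → Set b} → isTrunc m A → (∀ x → isTrunc m (P x)) → isTrunc m (Σ A P)
isTrunc-Σ zero     hA hP (x , y) (x′ , y′) = Σ-≡,≡→≡ (hA x x′ , hP x′ _ y′)
isTrunc-Σ (sucℕ m) hA hP (x , y) (x′ , y′) =
  isTrunc-↔ m Σ-≡,≡↔≡ (isTrunc-Σ m (hA x x′) (λ _ → hP x′ _ y′))

Σ-≡↔≡₁ : {P : A → Set b} → (∀ x → isProp (P x)) → {x x′ : A} {y : P x} {y′ : P x′}
  → (_≡_ {A = Σ A P} (x , y) (x′ , y′)) ↔ (x ≡ x′)
Σ-≡↔≡₁ pP {x′ = x′} {y′ = y′} = ↔-trans (↔-sym Σ-≡,≡↔≡)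
  (Σ-isContr-snd λ _ → pP x′ _ y′ , isProp⇒isSet (pP x′) _ _ _)

module _ (fe : FunExt) where

  funext : {P : A → Set b} {f g : (x : A) → P x} → (∀ x → f x ≡ g x) → f ≡ g
  funext {f = f} {g} = invEq (happly {f = f} {g = g} , fe)

  isTrunc-Π : ∀ m {P : A → Set b} → (∀ x → isTrunc m (P x)) → isTrunc m ((x : A) → P x)
  isTrunc-Π zero     h f g = funext λ x → h x (f x) (g x)
  isTrunc-Π (sucℕ m) h f g = isTrunc-↔ m (↔-sym (≃⇒↔ (happly , fe))) (isTrunc-Π m λ x → h x (f x) (g x))

  isProp-isTrunc : ∀ m → isProp (isTrunc m A)
  isProp-isTrunc zero     p q = funext λ x → funext λ y → isProp⇒isSet p x y (p x y) (q x y)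
  isProp-isTrunc (sucℕ m) h h′ = funext λ x → funext λ y → isProp-isTrunc m (h x y) (h′ x y)

  isProp-isContr : isProp (isContr A)
  isProp-isContr (c , h) = isTrunc-Σ zero pA (λ x → isTrunc-Π zero λ y → isProp⇒isSet pA x y) (c , h)
    where
    pA : isProp _
    pA x y = trans (sym (h x)) (h y)

  isProp-isEquiv : (f : A → B) → isProp (isEquiv f)
  isProp-isEquiv f = isTrunc-Π zero λ _ → isProp-isContr

  ≃-≡ : {e e′ : A ≃ B} → proj₁ e ≡ proj₁ e′ → e ≡ e′
  ≃-≡ p = Σ-≡,≡→≡ (p , isProp-isEquiv _ _ _)

  isTrunc-≃ : ∀ m → isTrunc m A → isTrunc m B → isTrunc m (A ≃ B)
  isTrunc-≃ m hA hB = isTrunc-Σ m (isTrunc-Π m λ _ → hB) λ f → isTrunc-≤ z≤n (isProp-isEquiv f)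

TypeOfLevel : ℕ → (a : Level) → Set (Level.suc a)
TypeOfLevel m a = Σ (Set a) (isTrunc m)

EssSmall-↔ : ∀ {ℓ} → X ↔ A → EssSmall ℓ X → EssSmall ℓ A
EssSmall-↔ X↔A (B , e) = B , ↔⇒≃ (↔-trans (≃⇒↔ e) X↔A)

module _ (fe : FunExt) (univ : Univalence) where

  ua : {A B : Set a} → A ≃ B → A ≡ B
  ua = invEq (idToEquiv , univ)

  isTrunc-TypeOfLevel : ∀ m → isTrunc (sucℕ m) (TypeOfLevel m a)
  isTrunc-TypeOfLevel m (A , p) (B , q) =
    isTrunc-↔ m (↔-sym (↔-trans (Σ-≡↔≡₁ λ _ → isProp-isTrunc fe m) (≃⇒↔ (idToEquiv , univ))))
      (isTrunc-≃ fe m p q)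

  isProp-EssSmall : ∀ {ℓ} → isProp (EssSmall ℓ X)
  isProp-EssSmall {X = X} (B , e) (B′ , e′) = Σ-≡,≡→≡ (ua d , ≃-≡ fe (funext fe λ y →
      trans (transport-≃ (ua d) y)
        (trans (cong (λ d′ → proj₁ e (invEq d′ y)) (secEq (idToEquiv , univ) d)) (secEq e (proj₁ e′ y)))))
    where
    d : B ≃ B′
    d = ↔⇒≃ (↔-trans (≃⇒↔ e) (↔-sym (≃⇒↔ e′)))
    transport-≃ : ∀ {C} (p : B ≡ C) (y : C) → proj₁ (subst (_≃ X) p e) y ≡ proj₁ e (invEq (idToEquiv p) y)
    transport-≃ refl y = refl

module TruncationOperations (T : Truncations) where
  open Truncations T

  ∥∥-rec : ∀ m → isTrunc m B → (A → B) → ∥ A ∥[ m -1] → B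
  ∥∥-rec m hB = ∥∥-elim m _ (λ _ → hB)

  ∥∥-map : ∀ m → (A → B) → ∥ A ∥[ m -1] → ∥ B ∥[ m -1]
  ∥∥-map m f = ∥∥-rec m (∥∥-isTrunc m) (λ x → ∣ f x ∣[ m -1])

  ∥∥-map-β : ∀ m (f : A → B) (x : A) → ∥∥-map m f ∣ x ∣[ m -1] ≡ ∣ f x ∣[ m -1]
  ∥∥-map-β m f = ∥∥-β m _ (λ _ → ∥∥-isTrunc m) (λ x → ∣ f x ∣[ m -1])

  ∥∥-↔ : ∀ m → A ↔ B → ∥ A ∥[ m -1] ↔ ∥ B ∥[ m -1]
  ∥∥-↔ m A↔B = mk↔ₛ′ (∥∥-map m to) (∥∥-map m from) (∥∥-map-inverse strictlyInverseˡ) (∥∥-map-inverse strictlyInverseʳ)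
    where
    open Inverse A↔B
    ∥∥-map-inverse : ∀ {c d} {C : Set c} {D : Set d} {f : C → D} {g : D → C} → (∀ x → f (g x) ≡ x) → ∀ t → ∥∥-map m f (∥∥-map m g t) ≡ t
    ∥∥-map-inverse {f = f} {g} fg = ∥∥-elim m _ (λ t → isTrunc-suc m (∥∥-isTrunc m) _ t) λ x →
      trans (cong (∥∥-map m f) (∥∥-map-β m g x)) (trans (∥∥-map-β m f (g x)) (cong (∣_∣[ m -1]) (fg x)))

  isEmbedding×isSurjection⇒isEquiv : {f : A → B} → isEmbedding f → isSurjection T f → isEquiv f
  isEmbedding×isSurjection⇒isEquiv emb surj y = ∥∥-rec 0 (emb y) id (surj y) , emb y _

  TruncImage : ∀ m → (A → X) → Set _
  TruncImage {X = X} m f = Σ X λ x → ∥ fib f x ∥[ m -1]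

  cover : ∀ m (f : A → X) → A → TruncImage m f
  cover m f x = f x , ∣ x , refl ∣[ m -1]

  cover-surjective : ∀ m (f : A → X) → isSurjection T (cover m f)
  cover-surjective m f (y , t) = ∥∥-elim m (λ t → ∥ fib (cover m f) (y , t) ∥[ 0 -1])
    (λ _ → isTrunc-≤ z≤n (∥∥-isTrunc 0)) (λ { (x , p) → ∣ preimage x p ∣[ 0 -1] }) t
    where
    preimage : ∀ {y} x (p : f x ≡ y) → fib (cover m f) (y , ∣ x , p ∣[ m -1])
    preimage x refl = x , refl

module _ (fe : FunExt) (univ : Univalence) (T : Truncations) where
  open Truncations T
  open TruncationOperations T

  -- Encode–decode, with the codes valued in the m-type of (m-1)-types.
  ∣∣-≡↔ : ∀ m (x y : A) → (∣ x ∣[ sucℕ m -1] ≡ ∣ y ∣[ sucℕ m -1]) ↔ ∥ x ≡ y ∥[ m -1]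
  ∣∣-≡↔ {a} {A} m x y = mk↔ₛ′ encode′ cong-∣∣ encode∘decode decode∘encode
    where
    ∣_∣ : A → ∥ A ∥[ sucℕ m -1]
    ∣ z ∣ = ∣ z ∣[ sucℕ m -1]

    codeOf : A → TypeOfLevel m a
    codeOf z = ∥ x ≡ z ∥[ m -1] , ∥∥-isTrunc m

    codes : ∥ A ∥[ sucℕ m -1] → TypeOfLevel m a
    codes = ∥∥-elim (sucℕ m) _ (λ _ → isTrunc-TypeOfLevel fe univ m) codeOf

    Code : ∥ A ∥[ sucℕ m -1] → Set a
    Code = proj₁ ∘ codes

    Code-β : ∀ z → Code ∣ z ∣ ≡ ∥ x ≡ z ∥[ m -1]
    Code-β z = cong proj₁ (∥∥-β (sucℕ m) _ (λ _ → isTrunc-TypeOfLevel fe univ m) codeOf z)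

    encode : ∀ s → ∣ x ∣ ≡ s → Code s
    encode s p = subst Code p (subst id (sym (Code-β x)) ∣ refl ∣[ m -1])

    cong-∣∣ : ∀ {z} → ∥ x ≡ z ∥[ m -1] → ∣ x ∣ ≡ ∣ z ∣
    cong-∣∣ = ∥∥-rec m (∥∥-isTrunc (sucℕ m) _ _) (cong ∣_∣)

    cong-∣∣-β : ∀ {z} (q : x ≡ z) → cong-∣∣ ∣ q ∣[ m -1] ≡ cong ∣_∣ q
    cong-∣∣-β = ∥∥-β m _ (λ _ → ∥∥-isTrunc (sucℕ m) _ _) (cong ∣_∣)

    Decode : ∥ A ∥[ sucℕ m -1] → Set a
    Decode s = Code s → ∣ x ∣ ≡ s

    isTrunc-Decode : ∀ s → isTrunc (sucℕ m) (Decode s)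
    isTrunc-Decode s = isTrunc-Π fe (sucℕ m) λ _ → isTrunc-suc m (∥∥-isTrunc (sucℕ m) _ s)

    decode-∣∣ : ∀ z → Decode ∣ z ∣
    decode-∣∣ z c = cong-∣∣ (subst id (Code-β z) c)

    decode : ∀ s → Decode s
    decode = ∥∥-elim (sucℕ m) Decode isTrunc-Decode decode-∣∣

    decode-β : ∀ z c → decode ∣ z ∣ c ≡ decode-∣∣ z c
    decode-β z c = cong (λ h → h c) (∥∥-β (sucℕ m) Decode isTrunc-Decode decode-∣∣ z)

    decode-encode : ∀ s (p : ∣ x ∣ ≡ s) → decode s (encode s p) ≡ p
    decode-encode _ refl =
      trans (decode-β x _) (trans (cong cong-∣∣ (subst-subst-sym {P = id} (Code-β x))) (cong-∣∣-β refl))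

    encode′ : ∣ x ∣ ≡ ∣ y ∣ → ∥ x ≡ y ∥[ m -1]
    encode′ p = subst id (Code-β y) (encode ∣ y ∣ p)

    decode∘encode : ∀ p → cong-∣∣ (encode′ p) ≡ p
    decode∘encode p = trans (sym (decode-β y _)) (decode-encode _ p)

    encode-cong : ∀ {z} (q : x ≡ z) → subst id (Code-β z) (encode ∣ z ∣ (cong ∣_∣ q)) ≡ ∣ q ∣[ m -1]
    encode-cong refl = subst-subst-sym {P = id} (Code-β x)

    encode∘decode : ∀ c → encode′ (cong-∣∣ c) ≡ c
    encode∘decode = ∥∥-elim m _ (λ c → isTrunc-suc m (∥∥-isTrunc m) _ c)
      λ q → trans (cong encode′ (cong-∣∣-β q)) (encode-cong q)

  subst-∣∣ : ∀ m (f : A → X) {x : A} {y : X} (q : f x ≡ y)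
    → subst (λ z → ∥ fib f z ∥[ m -1]) q ∣ x , refl ∣[ m -1] ≡ ∣ x , q ∣[ m -1]
  subst-∣∣ m f refl = refl

  cover-≡↔ : ∀ m (f : A → X) (x x′ : A)
    → (cover (sucℕ m) f x ≡ cover (sucℕ m) f x′) ↔ TruncImage m (λ (p : x ≡ x′) → cong f p)
  cover-≡↔ m f x x′ = begin
    cover (sucℕ m) f x ≡ cover (sucℕ m) f x′
      ↔⟨ ↔-sym Σ-≡,≡↔≡ ⟩
    Σ (f x ≡ f x′) (λ q → subst (λ z → ∥ fib f z ∥[ sucℕ m -1]) q ∣ x , refl ∣[ sucℕ m -1] ≡ ∣ x′ , refl ∣[ sucℕ m -1])
      ↔⟨ Σ-↔ ↔-refl (λ {q} → K-reflexive (cong (_≡ _) (subst-∣∣ (sucℕ m) f q))) ⟩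
    Σ (f x ≡ f x′) (λ q → ∣ x , q ∣[ sucℕ m -1] ≡ ∣ x′ , refl ∣[ sucℕ m -1])
      ↔⟨ Σ-↔ ↔-refl (λ {q} → ∣∣-≡↔ m (x , q) (x′ , refl)) ⟩
    Σ (f x ≡ f x′) (λ q → ∥ (x , q) ≡ (x′ , refl) ∥[ m -1])
      ↔⟨ Σ-↔ ↔-refl (λ {q} → ∥∥-↔ m (fib-≡↔fib-cong f q)) ⟩
    TruncImage m (cong f) ∎
    where open EquationalReasoning

  module _ {ℓ} (si : SmallImages T ℓ) where

    EssSmall-surjection : {A : Set ℓ} {I : Set b} → LocSmall (fin 1) ℓ I
      → (g : A → I) → isSurjection T g → EssSmall ℓ I
    EssSmall-surjection loc g g-surj = im , incl , isEmbedding×isSurjection⇒isEquiv incl-emb incl-surj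
      where
      open Image (si loc g) using (im; incl; incl-emb; incl∘cover) renaming (cover to g-cover)
      incl-surj : isSurjection T incl
      incl-surj y = ∥∥-map 0 (λ { (x , p) → g-cover x , trans (incl∘cover x) p }) (g-surj y)

    TruncImage-EssSmall : ∀ m {A : Set ℓ} {X : Set b} → LocSmall (fin (sucℕ m)) ℓ X
      → (f : A → X) → EssSmall ℓ (TruncImage m f)
    TruncImage-LocSmall : ∀ m {A : Set ℓ} {X : Set b} → LocSmall (fin (sucℕ m)) ℓ X
      → (f : A → X) → LocSmall (fin 1) ℓ (TruncImage m f)

    TruncImage-EssSmall m loc f = EssSmall-surjection (TruncImage-LocSmall m loc f) (cover m f) (cover-surjective m f)

    TruncImage-LocSmall zero loc f (x , _) (y , _) = EssSmall-↔ (↔-sym (Σ-≡↔≡₁ λ _ → ∥∥-isTrunc 0)) (loc x y)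
    TruncImage-LocSmall (sucℕ m) loc f i j =
      ∥∥-rec 0 (isProp-EssSmall fe univ) (λ (x , p) →
      ∥∥-rec 0 (isProp-EssSmall fe univ) (λ (x′ , p′) → paths-EssSmall x x′ p p′)
        (cover-surjective (sucℕ m) f j)) (cover-surjective (sucℕ m) f i)
      where
      paths-EssSmall : ∀ x x′ → cover (sucℕ m) f x ≡ i → cover (sucℕ m) f x′ ≡ j → EssSmall ℓ (i ≡ j)
      paths-EssSmall x x′ refl refl =
        EssSmall-↔ (↔-sym (cover-≡↔ m f x x′)) (TruncImage-EssSmall m (loc (f x) (f x′)) (cong f))

module _ {ℓ} {n : ℕ∞} {V : Set b} (sup : T[ n , ℓ ] V ≃ V) where

  ∈-sup↔ : (t : T[ n , ℓ ] V) (z : V) → (z ∈[ sup ] proj₁ sup t) ↔ fib (proj₁ (proj₂ t)) z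
  ∈-sup↔ t z = K-reflexive (cong (λ s → fib (proj₁ (proj₂ s)) z) (retEq sup t))

  ⋃-index : V → Set ℓ
  ⋃-index x = Σ (over sup x) λ a → over sup (tilde sup x a)

  ⋃-map : (x : V) → ⋃-index x → V
  ⋃-map x (a , c) = tilde sup (tilde sup x a) c

  fib-⋃-map↔ : (x z : V) → fib (⋃-map x) z ↔ Σ V (λ y → (z ∈[ sup ] y) × (y ∈[ sup ] x))
  fib-⋃-map↔ x z = mk↔ₛ′ to from to∘from (λ _ → refl)
    where
    to : ∀ {z} → fib (⋃-map x) z → Σ V (λ y → (z ∈[ sup ] y) × (y ∈[ sup ] x))
    to ((a , c) , p) = tilde sup x a , (c , p) , (a , refl)
    from : ∀ {z} → Σ V (λ y → (z ∈[ sup ] y) × (y ∈[ sup ] x)) → fib (⋃-map x) z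
    from (_ , (c , p) , (a , refl)) = (a , c) , p
    to∘from : ∀ {z} (w : Σ V (λ y → (z ∈[ sup ] y) × (y ∈[ sup ] x))) → to (from w) ≡ w
    to∘from (_ , (c , p) , (a , refl)) = refl

hasUnion-∞ : (T : Truncations) {ℓ : Level} {V : Set b} (sup : T[ ∞ , ℓ ] V ≃ V) → HasUnion T ∞ sup
hasUnion-∞ T {ℓ} {V} sup x = proj₁ sup t , λ z → ↔⇒≃ (↔-trans (∈-sup↔ sup t z) (fib-⋃-map↔ sup x z))
  where
  t : T[ ∞ , ℓ ] V
  t = ⋃-index sup x , ⋃-map sup x , λ _ → tt

hasUnion-fin : FunExt → Univalence → (T : Truncations) {ℓ : Level} → SmallImages T ℓ
  → {n : ℕ∞} {V : Set b} (sup : T[ n , ℓ ] V ≃ V) (m : ℕ) → fin m ≤∞ n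
  → LocSmall (fin (sucℕ m)) ℓ V → HasUnion T (fin m) sup
hasUnion-fin fe univ T {ℓ} si {n} {V} sup m m≤n loc x = proj₁ sup t , λ z → ↔⇒≃ (begin
    z ∈[ sup ] proj₁ sup t                        ↔⟨ ∈-sup↔ sup t z ⟩
    fib ⋃ z                                       ↔⟨ fib-proj₁∘≃ e z ⟩
    ∥ fib (⋃-map sup x) z ∥[ m -1]                ↔⟨ ∥∥-↔ m (fib-⋃-map↔ sup x z) ⟩
    ∥ Σ _ (λ y → (z ∈[ sup ] y) × (y ∈[ sup ] x)) ∥[ m -1] ∎)
  where
  open Truncations T
  open TruncationOperations T
  open EquationalReasoning
  small : EssSmall ℓ (TruncImage m (⋃-map sup x))
  small = TruncImage-EssSmall fe univ T si m loc (⋃-map sup x)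
  e : proj₁ small ≃ TruncImage m (⋃-map sup x)
  e = proj₂ small
  ⋃ : proj₁ small → V
  ⋃ = proj₁ ∘ proj₁ e
  t : T[ n , ℓ ] V
  t = proj₁ small , ⋃ , λ z → isTrunc-≤∞ m≤n (isTrunc-↔ m (↔-sym (fib-proj₁∘≃ e z)) (∥∥-isTrunc m))

mainTheorem5 : FunExt → Univalence → (T : Truncations) → {ℓ b : Level} → SmallImages T ℓ →
    (n : ℕ∞) (V : Set b) (sup : T[ n , ℓ ] V ≃ V) (k : ℕ∞) → k ≤∞ n →
    LocSmall (suc∞ k) ℓ V → HasUnion T k sup
mainTheorem5 fe univ T si n V sup ∞       (.∞ ≤∞∞) loc = hasUnion-∞ T sup
mainTheorem5 fe univ T si n V sup (fin m) m≤n      loc = hasUnion-fin fe univ T si sup m m≤n loc
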